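{- Let $MPR$ and $dWHA$ be the connected graded Hopf algebras described in the context. The $\mathbf{Z}$-linear map $\varphi: MPR\to dWHA$ defined on permutation words by $\varphi([t_1,\dots,t_n])=\binom{[x_1,x_2,\dots,x_n]}{[x_{t_1},x_{t_2},\dots,x_{t_n}]}$ (and sending the empty permutation to the empty substitution) is a monomorphism of connected graded Hopf algebras.
   Context: $MPR$: the free Abelian group $\mathbf{Z}\oplus\bigoplus_{n\ge1}\mathbf{Z}S_n$ with basis the empty word $[\,]$ and all permutation words $[s_1,\dots,s_m]$ (words over $\{1,\dots,m\}$ without repeats, representing $i\mapsto s_i$), graded by length. The shuffle product $\times_{sh}$ of words $[a_1,\dots,a_m]$, $[b_1,\dots,b_n]$ is the sum with multiplicities of all interleavings preserving the relative order of the $a$'s and of the $b$'s. Multiplication on $MPR$: $[a_1,\dots,a_m]\cdot[b_1,\dots,b_n]=[a_1,\dots,a_m]\times_{sh}[m+b_1,\dots,m+b_n]$, unit $[\,]$. For a word $\alpha=[a_1,\dots,a_m]$ over positive integers without repeats, $st(\alpha)=[\psi(a_1),\dots,\psi(a_m)]$ with $\psi:\{a_1,\dots,a_m\}\to\{1,\dots,m\}$ the unique strictly increasing bijection. Comultiplication on $MPR$: $\mu(\alpha)=\sum_{\alpha=\alpha_1\alpha_2}st(\alpha_1)\otimes st(\alpha_2)$ over all cuts (concatenation decompositions, trivial ones included); counit is $1$ on $[\,]$ and $0$ on $S_n$, $n\ge1$. $dWHA$: fix an alphabet $\mathcal{X}=\{x_1,x_2,\dots\}$; a substitution is a pair of words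 $\binom{\rho}{\sigma}$ over $\mathcal{X}$ with equal supports (support = set of distinct letters), up to simultaneous renaming of letters by a bijection; $dWHA$ is free Abelian on substitutions (including the empty one), graded by $\deg\binom{\rho}{\sigma}=\#\mathrm{supp}(\rho)$. Product: writing two substitutions with disjoint supports, $\binom{\rho}{\sigma}\cdot\binom{\rho'}{\sigma'}=\sum_\gamma\binom{\rho\rho'}{\gamma}$ over terms $\gamma$ of $\sigma\times_{sh}\sigma'$. A cut $\sigma=\sigma_1\sigma_2$ is good if $\mathrm{supp}(\sigma_1)\cap\mathrm{supp}(\sigma_2)=\emptyset$; for $p=\binom{\rho}{\sigma}$, $p^{ -1}(\sigma_1)$ is the subword of $\rho$ of all letters in $\mathrm{supp}(\sigma_1)$. Coproduct: $\mu\binom{\rho}{\sigma}=\sum\binom{p^{ -1}(\sigma_1)}{\sigma_1}\otimes\binom{p^{ -1}(\sigma_2)}{\sigma_2}$ over good cuts. Unit is the empty substitution, counit is $1$ on it and $0$ on others; the antipodes are the unique ones of these connected graded bialgebras. -}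

module Defs where

open import Data.Nat as ℕ using (ℕ; zero; suc; _≤_; _<?_; _⊔_)
open import Data.Integer as ℤ using (ℤ; +_; -_) renaming (_+_ to _+ℤ_; _*_ to _*ℤ_)
open import Data.List using (List; []; _∷_; [_]; _++_; map; length; take; drop; filter; concatMap; foldr; upTo; deduplicate)
open import Data.List.Properties using (≡-dec)
open import Data.List.Membership.DecPropositional ℕ._≟_ using (_∈_; _∈?_)
open import Data.List.Relation.Unary.All using (All)
open import Data.List.Relation.Unary.Unique.Propositional using (Unique)
open import Data.Product using (_×_; _,_; proj₁; proj₂)
open import Data.Bool using (Bool; true; false; if_then_else_; _∧_)
open import Relation.Binary.PropositionalEquality using (_≡_)
open import Relation.Nullary using (Dec; yes; no; ¬_)
open import Relation.Nullary.Decidable using (⌊_⌋)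

-- words over positive integers (letter x_i of 𝒳 is the number i)
Word : Set
Word = List ℕ

shuffle : Word → Word → List Word
shuffle [] ys = [ ys ]
shuffle (x ∷ xs) [] = [ x ∷ xs ]
shuffle (x ∷ xs) (y ∷ ys) =
  map (x ∷_) (shuffle xs (y ∷ ys)) ++ map (y ∷_) (shuffle (x ∷ xs) ys)

cutPoints : Word → List ℕ
cutPoints w = upTo (suc (length w))

properCutPoints : Word → List ℕ
properCutPoints w = filter (λ k → 0 ℕ.<? k) (filter (λ k → k ℕ.<? length w) (upTo (length w)))

-- the free Abelian group on a basis B, represented by finite formal
-- ℤ-linear combinations (equality is the coefficientwise equality ≈ below)
FA : Set → Set
FA B = List (ℤ × B)

scale : {B : Set} → ℤ → FA B → FA B
scale c = map (λ { (d , b) → (c *ℤ d , b) })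

neg : {B : Set} → FA B → FA B
neg = scale (- (+ 1))

basis : {B : Set} → B → FA B
basis b = [ (+ 1 , b) ]

lin : {A B : Set} → (A → FA B) → FA A → FA B
lin f = concatMap (λ { (c , a) → scale c (f a) })

bilin : {A B C : Set} → (A → B → FA C) → FA A → FA B → FA C
bilin f x y = concatMap (λ { (c , a) → concatMap (λ { (d , b) → scale (c *ℤ d) (f a b) }) y }) x

-- tensor product of linear maps (basis of A ⊗ B is A × B)
tensorMap : {A B C D : Set} → (A → FA C) → (B → FA D) → FA (A × B) → FA (C × D)
tensorMap f g = lin (λ { (a , b) → bilin (λ c d → basis (c , d)) (f a) (g b) })

coeff : {B : Set} → (B → B → Bool) → B → FA B → ℤ
coeff eq b = foldr (λ { (c , b′) acc → (if eq b b′ then c else + 0) +ℤ acc }) (+ 0)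

Eq : {B : Set} → (B → B → Bool) → FA B → FA B → Set
Eq {B} eq x y = (b : B) → coeff eq b x ≡ coeff eq b y

sumIf : {B : Set} → (B → Bool) → FA B → ℤ
sumIf p = foldr (λ { (c , b) acc → (if p b then c else + 0) +ℤ acc }) (+ 0)

wordEq : Word → Word → Bool
wordEq u v = ⌊ ≡-dec ℕ._≟_ u v ⌋

isEmpty : Word → Bool
isEmpty [] = true
isEmpty (_ ∷ _) = false

IsPerm : Word → Set
IsPerm w = Unique w × All (λ a → 1 ≤ a × a ≤ length w) w

MPR : Set
MPR = FA Word

InMPR : MPR → Set
InMPR x = All (λ { (c , w) → IsPerm w }) x

_≈M_ : MPR → MPR → Set
_≈M_ = Eq wordEq

shift : ℕ → Word → Word
shift m = map (m ℕ.+_)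

mulMb : Word → Word → MPR
mulMb a b = map (λ w → (+ 1 , w)) (shuffle a (shift (length a) b))

mulM : MPR → MPR → MPR
mulM = bilin mulMb

unitM : MPR
unitM = basis []

st : Word → Word
st α = map (λ a → suc (length (filter (λ b → b <? a) α))) α

MPR⊗MPR : Set
MPR⊗MPR = FA (Word × Word)

_≈MM_ : MPR⊗MPR → MPR⊗MPR → Set
_≈MM_ = Eq (λ { (a , b) (c , d) → wordEq a c ∧ wordEq b d })

ΔMb : Word → MPR⊗MPR
ΔMb w = map (λ k → (+ 1 , (st (take k w) , st (drop k w)))) (cutPoints w)

ΔM : MPR → MPR⊗MPR
ΔM = lin ΔMb

εM : MPR → ℤ
εM = sumIf isEmpty

-- antipode by Takeuchi's recursion:
-- S [] = [] ,  S w = - w - Σ_{proper cuts w = w₁w₂} S(st w₁)·st w₂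
SMb-fuel : ℕ → Word → MPR
SMb-fuel _ [] = unitM
SMb-fuel zero (_ ∷ _) = []
SMb-fuel (suc n) w@(_ ∷ _) =
  neg (basis w ++
       concatMap (λ k → mulM (SMb-fuel n (st (take k w))) (basis (st (drop k w))))
                 (properCutPoints w))

SM : MPR → MPR
SM = lin (λ w → SMb-fuel (length w) w)

-- a substitution (ρ over σ), letters of 𝒳 coded as natural numbers
Subst : Set
Subst = Word × Word

IsSubst : Subst → Set
IsSubst (ρ , σ) = (a : ℕ) → (a ∈ ρ → a ∈ σ) × (a ∈ σ → a ∈ ρ)

indexOf : ℕ → List ℕ → ℕ
indexOf a [] = 0
indexOf a (b ∷ bs) = if ⌊ a ℕ.≟ b ⌋ then 0 else suc (indexOf a bs)

-- canonical representative modulo simultaneous renaming of letters by a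
-- bijection: letters are renamed 0,1,2,… in order of first occurrence in ρσ
canon : Subst → Subst
canon (ρ , σ) = (map r ρ , map r σ)
  where
  r : ℕ → ℕ
  r a = indexOf a (deduplicate ℕ._≟_ (ρ ++ σ))

-- two substitutions are equal iff they differ by a renaming of letters
substEq : Subst → Subst → Bool
substEq p q = wordEq (proj₁ (canon p)) (proj₁ (canon q)) ∧ wordEq (proj₂ (canon p)) (proj₂ (canon q))

dWHA : Set
dWHA = FA Subst

_≈D_ : dWHA → dWHA → Set
_≈D_ = Eq substEq

degD : Subst → ℕ
degD (ρ , σ) = length (deduplicate ℕ._≟_ ρ)

maxLetter : Word → ℕ
maxLetter = foldr _⊔_ 0

-- product: rename the second substitution so that supports are disjoint
mulDb : Subst → Subst → dWHA
mulDb (ρ , σ) (ρ′ , σ′) =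
  map (λ γ → (+ 1 , (ρ ++ shift k ρ′ , γ))) (shuffle σ (shift k σ′))
  where
  k : ℕ
  k = suc (maxLetter ρ ⊔ maxLetter σ)

mulD : dWHA → dWHA → dWHA
mulD = bilin mulDb

unitD : dWHA
unitD = basis ([] , [])

disjoint : Word → Word → Bool
disjoint u v = foldr (λ a acc → (if ⌊ a ∈? v ⌋ then false else true) ∧ acc) true u

preimage : Word → Word → Word
preimage ρ τ = filter (λ a → a ∈? τ) ρ

goodCuts : Word → List ℕ → List ℕ
goodCuts σ = filter (λ k → Data.Bool._≟_ (disjoint (take k σ) (drop k σ)) true)
  where import Data.Bool

dWHA⊗dWHA : Set
dWHA⊗dWHA = FA (Subst × Subst)

_≈DD_ : dWHA⊗dWHA → dWHA⊗dWHA → Set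
_≈DD_ = Eq (λ { (a , b) (c , d) → substEq a c ∧ substEq b d })

cutSubst : Subst → ℕ → Subst × Subst
cutSubst (ρ , σ) k = ((preimage ρ (take k σ) , take k σ) , (preimage ρ (drop k σ) , drop k σ))

ΔDb : Subst → dWHA⊗dWHA
ΔDb (ρ , σ) = map (λ k → (+ 1 , cutSubst (ρ , σ) k)) (goodCuts σ (cutPoints σ))

ΔD : dWHA → dWHA⊗dWHA
ΔD = lin ΔDb

isEmptySubst : Subst → Bool
isEmptySubst (ρ , σ) = isEmpty ρ ∧ isEmpty σ

εD : dWHA → ℤ
εD = sumIf isEmptySubst

-- antipode by Takeuchi's recursion over the proper good cuts of σ
SDb-fuel : ℕ → Subst → dWHA
SDb-fuel _ (ρ , []) = basis (ρ , [])
SDb-fuel zero (ρ , _ ∷ _) = []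
SDb-fuel (suc n) (ρ , σ@(_ ∷ _)) =
  neg (basis (ρ , σ) ++
       concatMap (λ k → mulD (SDb-fuel n (proj₁ (cutSubst (ρ , σ) k)))
                             (basis (proj₂ (cutSubst (ρ , σ) k))))
                 (goodCuts σ (properCutPoints σ)))

SD : dWHA → dWHA
SD = lin (λ p → SDb-fuel (length (proj₂ p)) p)

φb : Word → Subst
φb w = (map suc (upTo (length w)) , w)

φ : MPR → dWHA
φ = lin (λ w → basis (φb w))

φ⊗φ : MPR⊗MPR → dWHA⊗dWHA
φ⊗φ = tensorMap (λ w → basis (φb w)) (λ w → basis (φb w))

{-# OPTIONS --safe #-}
-- Substitutions are identified up to renaming of
-- letters, i.e. up to equality of canonical forms, and every structure map of dWHA commutes with
-- renamings that are injective on the letters involved, so it suffices to match the two sides of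
-- each identity term by term up to renaming.  For products, MPR shifts the right factor by the
-- length of the left one while dWHA shifts it by a fresh offset; the results differ by a renaming.
-- For coproducts, every cut of a permutation word is good, and each half of φ w at a cut is φ of
-- the standardised half renamed by the standardisation map.  The antipodes then agree by induction
-- along Takeuchi's recursion, which has the same shape on both sides.  Finally φ v and φ w differ by
-- a renaming only if v = w, since the common top row x₁ … xₙ pins the renaming down.

module Submission where

open import Defs
open import Data.List using (length)
open import Data.Product using (_×_)
open import Relation.Binary.PropositionalEquality using (_≡_)

open import Level using (0ℓ)
open import Function using (_∘_; _⇔_; mk⇔; Equivalence)
open import Data.Bool using (Bool; true; false; T; if_then_else_; _∧_)
open import Data.Bool.Properties using (T-∧)
open import Data.Nat as ℕ using (ℕ; zero; suc; pred; _≤_; _<_; _<?_; _∸_; _⊔_; z≤n; s≤s)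
import Data.Nat.Properties as ℕ
open import Data.Integer as ℤ using (ℤ; +_; -_) renaming (_+_ to _+ℤ_; _*_ to _*ℤ_)
import Data.Integer.Properties as ℤ
open import Data.List as List
  using (List; []; _∷_; _++_; map; take; drop; filter; concatMap; upTo; applyUpTo; deduplicate)
import Data.List.Properties as List
open import Data.List.Membership.Propositional using (_∈_)
open import Data.List.Membership.DecPropositional ℕ._≟_ using (_∈?_)
import Data.List.Membership.Propositional.Properties as ∈
open import Data.List.Membership.Propositional.Properties.WithK using (unique∧set⇒bag)
open import Data.List.Relation.Unary.Any as Any using (here; there)
open import Data.List.Relation.Unary.All as All using (All; []; _∷_)
import Data.List.Relation.Unary.All.Properties as All
open import Data.List.Relation.Unary.AllPairs as AllPairs using (AllPairs; []; _∷_)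
import Data.List.Relation.Unary.AllPairs.Properties as AllPairs
open import Data.List.Relation.Unary.Unique.Propositional using (Unique)
open import Data.List.Relation.Unary.Unique.DecPropositional ℕ._≟_ using (unique?)
import Data.List.Relation.Unary.Unique.Propositional.Properties as Unique
open import Data.List.Relation.Binary.Pointwise as Pointwise using (Pointwise; []; _∷_)
open import Data.List.Relation.Binary.Subset.Propositional using (_⊆_)
import Data.List.Relation.Binary.Subset.Propositional.Properties as ⊆
open import Data.List.Relation.Binary.Permutation.Propositional
  using (_↭_; ↭-refl; ↭-reflexive; ↭-sym; ↭-trans; ↭-prep; ↭⇒↭ₛ)
import Data.List.Relation.Binary.Permutation.Propositional.Properties as ↭
import Data.List.Relation.Binary.Permutation.Setoid.Properties as ↭ₛ
open import Data.List.Relation.Binary.BagAndSetEquality using (∼bag⇒↭)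
import Data.Product.Relation.Binary.Pointwise.NonDependent as ×
open import Data.Product using (_,_; proj₁; proj₂; map₂)
open import Data.Sum using (_⊎_; inj₁; inj₂)
open import Data.Empty using (⊥; ⊥-elim)
open import Relation.Nullary using (¬_; yes; no; does; ¬?)
open import Relation.Nullary.Decidable using (isYes; isYes≗does; toWitness; fromWitness; does-⇔; _×-dec_)
open import Relation.Unary using (Decidable)
open import Relation.Binary using (Rel; IsEquivalence; Setoid)
import Relation.Binary.Reasoning.Setoid
open import Relation.Binary.PropositionalEquality as ≡
  using (_≢_; refl; sym; trans; cong; cong₂; subst; module ≡-Reasoning)

filter-map : {A B : Set} {P : B → Set} {Q : A → Set} (P? : Decidable P) (Q? : Decidable Q) (h : A → B) {l : List A} →
             (∀ {x} → x ∈ l → P (h x) ⇔ Q x) → filter P? (map h l) ≡ map h (filter Q? l)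
filter-map P? Q? h {[]} _ = refl
filter-map P? Q? h {x ∷ l} P⇔Q with Q? x
... | yes q = trans (List.filter-accept P? (Equivalence.from (P⇔Q (here refl)) q))
                    (cong (h x ∷_) (filter-map P? Q? h (P⇔Q ∘ there)))
... | no ¬q = trans (List.filter-reject P? (¬q ∘ Equivalence.to (P⇔Q (here refl))))
                    (filter-map P? Q? h (P⇔Q ∘ there))

++-⊆ : {A : Set} {xs ys zs : List A} → xs ⊆ zs → ys ⊆ zs → xs ++ ys ⊆ zs
++-⊆ {xs = xs} xs⊆ ys⊆ x∈ with ∈.∈-++⁻ xs x∈
... | inj₁ x∈xs = xs⊆ x∈xs
... | inj₂ x∈ys = ys⊆ x∈ys

take-⊆ : {A : Set} (k : ℕ) (xs : List A) → take k xs ⊆ xs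
take-⊆ k xs = subst (take k xs ⊆_) (List.take++drop≡id k xs) (⊆.xs⊆xs++ys _ _)

drop-⊆ : {A : Set} (k : ℕ) (xs : List A) → drop k xs ⊆ xs
drop-⊆ k xs = subst (drop k xs ⊆_) (List.take++drop≡id k xs) (⊆.xs⊆ys++xs _ _)

map⁺-All : {A B C : Set} {R : B → C → Set} {P : A → Set} {f : A → B} {g : A → C} →
           (∀ {x} → P x → R (f x) (g x)) → ∀ {xs} → All P xs → Pointwise R (map f xs) (map g xs)
map⁺-All f∼g [] = []
map⁺-All f∼g (p ∷ ps) = f∼g p ∷ map⁺-All f∼g ps

concatMap⁺ : {A B : Set} {R : Rel B 0ℓ} {f g : A → List B} →
             (∀ x → Pointwise R (f x) (g x)) → ∀ xs → Pointwise R (concatMap f xs) (concatMap g xs)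
concatMap⁺ f∼g [] = []
concatMap⁺ f∼g (x ∷ xs) = Pointwise.++⁺ (f∼g x) (concatMap⁺ f∼g xs)

map-≡⇒agree : {A B : Set} {f g : A → B} {l : List A} {a : A} → map f l ≡ map g l → a ∈ l → f a ≡ g a
map-≡⇒agree {l = x ∷ l} eq (here refl) = proj₁ (List.∷-injective eq)
map-≡⇒agree {l = x ∷ l} eq (there a∈) = map-≡⇒agree (proj₂ (List.∷-injective eq)) a∈

unique-++-disjoint : {A : Set} {a : A} (xs : List A) {ys : List A} → Unique (xs ++ ys) → a ∈ xs → a ∈ ys → ⊥
unique-++-disjoint (x ∷ xs) (x∉ ∷ _) (here refl) a∈ys = All.lookup x∉ (∈.∈-++⁺ʳ xs a∈ys) refl
unique-++-disjoint (x ∷ xs) (_ ∷ xs++ys-unique) (there a∈xs) a∈ys = unique-++-disjoint xs xs++ys-unique a∈xs a∈ys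

deduplicate-unique : ∀ {l} → Unique l → deduplicate ℕ._≟_ l ≡ l
deduplicate-unique [] = refl
deduplicate-unique {x ∷ l} (x∉l ∷ l-unique) =
  cong (x ∷_) (trans (cong (filter _) (deduplicate-unique l-unique)) (List.filter-all (¬? ∘ (x ℕ.≟_)) x∉l))

applyUpTo-+ : {A : Set} (f : ℕ → A) (n m : ℕ) → applyUpTo f (n ℕ.+ m) ≡ applyUpTo f n ++ applyUpTo (f ∘ (n ℕ.+_)) m
applyUpTo-+ f zero m = refl
applyUpTo-+ f (suc n) m = cong (f 0 ∷_) (applyUpTo-+ (f ∘ suc) n m)

scale-* : {A : Set} (c d : ℤ) (X : FA A) → scale (c *ℤ d) X ≡ scale c (scale d X)
scale-* c d [] = refl
scale-* c d ((e , a) ∷ X) = cong₂ _∷_ (cong (_, a) (ℤ.*-assoc c d e)) (scale-* c d X)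

scale-identity : {A : Set} (X : FA A) → scale (+ 1) X ≡ X
scale-identity [] = refl
scale-identity ((e , a) ∷ X) = cong₂ _∷_ (cong (_, a) (ℤ.*-identityˡ e)) (scale-identity X)

lin-cong : {A B : Set} {f g : A → FA B} → (∀ a → f a ≡ g a) → ∀ X → lin f X ≡ lin g X
lin-cong f≗g = List.concatMap-cong (λ { (c , a) → cong (scale c) (f≗g a) })

lin-++ : {A B : Set} (f : A → FA B) (X Y : FA A) → lin f (X ++ Y) ≡ lin f X ++ lin f Y
lin-++ f = List.concatMap-++ _

lin-scale : {A B : Set} (f : A → FA B) (c : ℤ) (X : FA A) → lin f (scale c X) ≡ scale c (lin f X)
lin-scale f c [] = refl
lin-scale f c ((d , a) ∷ X) = begin
  scale (c *ℤ d) (f a) ++ lin f (scale c X)        ≡⟨ cong₂ _++_ (scale-* c d (f a)) (lin-scale f c X) ⟩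
  scale c (scale d (f a)) ++ scale c (lin f X)     ≡⟨ List.map-++ _ (scale d (f a)) (lin f X) ⟨
  scale c (scale d (f a) ++ lin f X)               ∎
  where open ≡-Reasoning

lin-basis : {A B : Set} (f : A → FA B) (a : A) → lin f (basis a) ≡ f a
lin-basis f a = trans (List.++-identityʳ _) (scale-identity (f a))

lin-basis-map : {A B : Set} (h : A → B) (X : FA A) → lin (basis ∘ h) X ≡ map (map₂ h) X
lin-basis-map h [] = refl
lin-basis-map h ((c , a) ∷ X) = cong₂ _∷_ (cong (_, h a) (ℤ.*-identityʳ c)) (lin-basis-map h X)

lin-concatMap : {A B C : Set} (f : A → FA B) (g : C → FA A) (l : List C) →
                lin f (concatMap g l) ≡ concatMap (lin f ∘ g) l
lin-concatMap f g [] = refl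
lin-concatMap f g (x ∷ l) = trans (lin-++ f (g x) (concatMap g l)) (cong (lin f (g x) ++_) (lin-concatMap f g l))

bilin-lin : {A B C : Set} (f : A → B → FA C) (X : FA A) (Y : FA B) → bilin f X Y ≡ lin (λ a → lin (f a) Y) X
bilin-lin f [] Y = refl
bilin-lin f ((c , a) ∷ X) Y =
  cong₂ _++_ (trans (sym (List.concatMap-map _ _ Y)) (lin-scale (f a) c Y)) (bilin-lin f X Y)

lin-lin : {A B C : Set} (f : B → FA C) (g : A → FA B) (X : FA A) → lin f (lin g X) ≡ lin (lin f ∘ g) X
lin-lin f g [] = refl
lin-lin f g ((c , a) ∷ X) =
  trans (lin-++ f (scale c (g a)) (lin g X)) (cong₂ _++_ (lin-scale f c (g a)) (lin-lin f g X))

lin-lin-basis : {A B C : Set} (f : B → FA C) (h : A → B) (X : FA A) → lin f (lin (basis ∘ h) X) ≡ lin (f ∘ h) X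
lin-lin-basis f h X = trans (lin-lin f (basis ∘ h) X) (lin-cong (lin-basis f ∘ h) X)

scale-All : {B : Set} {P : B → Set} (c : ℤ) {X : FA B} → All (P ∘ proj₂) X → All (P ∘ proj₂) (scale c X)
scale-All c = All.map⁺

lin-All : {A B : Set} {P : A → Set} {Q : B → Set} {f : A → FA B} →
          (∀ {a} → P a → All (Q ∘ proj₂) (f a)) → ∀ {X} → All (P ∘ proj₂) X → All (Q ∘ proj₂) (lin f X)
lin-All f-ok [] = []
lin-All f-ok {(c , _) ∷ _} (p ∷ ps) = All.++⁺ (scale-All c (f-ok p)) (lin-All f-ok ps)

concatMap-All : {A B : Set} {P : B → Set} {f : A → List B} → (∀ x → All P (f x)) → ∀ xs → All P (concatMap f xs)
concatMap-All f-ok xs = All.concat⁺ (All.map⁺ (All.universal f-ok xs))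

Termwise : {B : Set} → Rel B 0ℓ → Rel (FA B) 0ℓ
Termwise R = Pointwise (×.Pointwise _≡_ R)

Termwise-isEquivalence : {B : Set} {R : Rel B 0ℓ} → IsEquivalence R → IsEquivalence (Termwise R)
Termwise-isEquivalence R-equiv = Pointwise.isEquivalence (×.×-isEquivalence ≡.isEquivalence R-equiv)

scale⁺ : {B : Set} {R : Rel B 0ℓ} (c : ℤ) {X Y : FA B} → Termwise R X Y → Termwise R (scale c X) (scale c Y)
scale⁺ c [] = []
scale⁺ c ((refl , r) ∷ rs) = (refl , r) ∷ scale⁺ c rs

lin⁺ : {A B : Set} {R : Rel A 0ℓ} {S : Rel B 0ℓ} {f g : A → FA B} →
       (∀ {a b} → R a b → Termwise S (f a) (g b)) →
       ∀ {X Y} → Termwise R X Y → Termwise S (lin f X) (lin g Y)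
lin⁺ f∼g [] = []
lin⁺ f∼g (_∷_ {x = c , _} (refl , r) rs) = Pointwise.++⁺ (scale⁺ c (f∼g r)) (lin⁺ f∼g rs)

lin⁺-All : {A B : Set} {P : A → Set} {S : Rel B 0ℓ} {f g : A → FA B} →
           (∀ {a} → P a → Termwise S (f a) (g a)) →
           ∀ {X} → All (P ∘ proj₂) X → Termwise S (lin f X) (lin g X)
lin⁺-All f∼g [] = []
lin⁺-All f∼g {(c , _) ∷ _} (p ∷ ps) = Pointwise.++⁺ (scale⁺ c (f∼g p)) (lin⁺-All f∼g ps)

Termwise⇒Eq : {B : Set} {R : Rel B 0ℓ} (eq : B → B → Bool) → (∀ s {p q} → R p q → eq s p ≡ eq s q) →
              ∀ {X Y} → Termwise R X Y → Eq eq X Y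
Termwise⇒Eq eq resp [] s = refl
Termwise⇒Eq eq resp ((refl , r) ∷ rs) s =
  cong₂ _+ℤ_ (cong (λ b → if b then _ else + 0) (resp s r)) (Termwise⇒Eq eq resp rs s)

shuffle-map : (h : ℕ → ℕ) (u v : Word) → shuffle (map h u) (map h v) ≡ map (map h) (shuffle u v)
shuffle-map h [] v = refl
shuffle-map h (x ∷ u) [] = refl
shuffle-map h (x ∷ u) (y ∷ v) = begin
  map (h x ∷_) (shuffle (map h u) (h y ∷ map h v)) ++ map (h y ∷_) (shuffle (h x ∷ map h u) (map h v))
    ≡⟨ cong₂ (λ s t → map (h x ∷_) s ++ map (h y ∷_) t) (shuffle-map h u (y ∷ v)) (shuffle-map h (x ∷ u) v) ⟩
  map (h x ∷_) (map (map h) (shuffle u (y ∷ v))) ++ map (h y ∷_) (map (map h) (shuffle (x ∷ u) v))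
    ≡⟨ cong₂ _++_ (List.map-∘ (shuffle u (y ∷ v))) (List.map-∘ (shuffle (x ∷ u) v)) ⟨
  map (map h ∘ (x ∷_)) (shuffle u (y ∷ v)) ++ map (map h ∘ (y ∷_)) (shuffle (x ∷ u) v)
    ≡⟨ cong₂ _++_ (List.map-∘ (shuffle u (y ∷ v))) (List.map-∘ (shuffle (x ∷ u) v)) ⟩
  map (map h) (map (x ∷_) (shuffle u (y ∷ v))) ++ map (map h) (map (y ∷_) (shuffle (x ∷ u) v))
    ≡⟨ List.map-++ (map h) (map (x ∷_) (shuffle u (y ∷ v))) _ ⟨
  map (map h) (map (x ∷_) (shuffle u (y ∷ v)) ++ map (y ∷_) (shuffle (x ∷ u) v)) ∎
  where open ≡-Reasoning

shuffle-↭ : (u v : Word) → All (_↭ u ++ v) (shuffle u v)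
shuffle-↭ [] v = ↭-refl ∷ []
shuffle-↭ (x ∷ u) [] = ↭-reflexive (cong (x ∷_) (sym (List.++-identityʳ u))) ∷ []
shuffle-↭ (x ∷ u) (y ∷ v) = All.++⁺
  (All.map⁺ (All.map (↭-prep x) (shuffle-↭ u (y ∷ v))))
  (All.map⁺ (All.map (λ γ↭ → ↭-trans (↭-prep y γ↭) (↭-sym (↭.shift y (x ∷ u) v))) (shuffle-↭ (x ∷ u) v)))

-- Renamings and canonical forms of substitutions

InjectiveOn : (ℕ → ℕ) → List ℕ → Set
InjectiveOn h l = ∀ {a b} → a ∈ l → b ∈ l → h a ≡ h b → a ≡ b

InjectiveOn-⊆ : ∀ {h l m} → m ⊆ l → InjectiveOn h l → InjectiveOn h m
InjectiveOn-⊆ m⊆l inj a∈m b∈m = inj (m⊆l a∈m) (m⊆l b∈m)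

map-injectiveOn : ∀ {h D u v} → InjectiveOn h D → u ⊆ D → v ⊆ D → map h u ≡ map h v → u ≡ v
map-injectiveOn {u = []} {[]} _ _ _ _ = refl
map-injectiveOn {u = x ∷ u} {y ∷ v} inj u⊆ v⊆ eq = cong₂ _∷_
  (inj (u⊆ (here refl)) (v⊆ (here refl)) (proj₁ (List.∷-injective eq)))
  (map-injectiveOn inj (u⊆ ∘ there) (v⊆ ∘ there) (proj₂ (List.∷-injective eq)))

∈-map-injectiveOn : ∀ {h a v} → InjectiveOn h (a ∷ v) → h a ∈ map h v ⇔ a ∈ v
∈-map-injectiveOn {h} {a} {v} inj = mk⇔ from (∈.∈-map⁺ h)
  where
  from : h a ∈ map h v → a ∈ v
  from ha∈ with b , b∈ , ha≡hb ← ∈.∈-map⁻ h ha∈ = subst (_∈ v) (sym (inj (here refl) (there b∈) ha≡hb)) b∈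

deduplicate-map : ∀ {h l} → InjectiveOn h l → deduplicate ℕ._≟_ (map h l) ≡ map h (deduplicate ℕ._≟_ l)
deduplicate-map {h} {[]} _ = refl
deduplicate-map {h} {x ∷ l} inj = cong (h x ∷_) (begin
  filter (¬? ∘ (h x ℕ.≟_)) (deduplicate ℕ._≟_ (map h l))
    ≡⟨ cong (filter _) (deduplicate-map (InjectiveOn-⊆ there inj)) ⟩
  filter (¬? ∘ (h x ℕ.≟_)) (map h (deduplicate ℕ._≟_ l))
    ≡⟨ filter-map _ _ h (λ y∈ → mk⇔ (λ hx≢hy x≡y → hx≢hy (cong h x≡y))
                                    (λ x≢y hx≡hy → x≢y (inj (here refl) (there (∈-l y∈)) hx≡hy))) ⟩
  map h (filter (¬? ∘ (x ℕ.≟_)) (deduplicate ℕ._≟_ l)) ∎)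
  where
  open ≡-Reasoning
  ∈-l : deduplicate ℕ._≟_ l ⊆ l
  ∈-l = ∈.∈-deduplicate⁻ ℕ._≟_ l

indexOf-map : ∀ {h a L} → InjectiveOn h (a ∷ L) → indexOf (h a) (map h L) ≡ indexOf a L
indexOf-map {L = []} _ = refl
indexOf-map {h} {a} {b ∷ L} inj with a ℕ.≟ b | h a ℕ.≟ h b
... | yes _   | yes _     = refl
... | yes a≡b | no ha≢hb  = ⊥-elim (ha≢hb (cong h a≡b))
... | no a≢b  | yes ha≡hb = ⊥-elim (a≢b (inj (here refl) (there (here refl)) ha≡hb))
... | no _    | no _      =
  cong suc (indexOf-map (InjectiveOn-⊆ (λ { (here e) → here e ; (there m) → there (there m) }) inj))

indexOf-injective : ∀ {a b L} → a ∈ L → b ∈ L → indexOf a L ≡ indexOf b L → a ≡ b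
indexOf-injective {a} {b} {x ∷ L} a∈ b∈ eq with a ℕ.≟ x | b ℕ.≟ x
... | yes a≡x | yes b≡x = trans a≡x (sym b≡x)
... | yes _   | no _    = ⊥-elim (ℕ.0≢1+n eq)
... | no _    | yes _   = ⊥-elim (ℕ.0≢1+n (sym eq))
... | no a≢x  | no b≢x  = indexOf-injective (Any.tail a≢x a∈) (Any.tail b≢x b∈) (ℕ.suc-injective eq)

indexOf-there : ∀ {a x} S → a ≢ x → indexOf a (x ∷ S) ≡ suc (indexOf a S)
indexOf-there {a} {x} S a≢x with a ℕ.≟ x
... | yes a≡x = ⊥-elim (a≢x a≡x)
... | no _    = refl

indexOf-self : ∀ S → Unique S → map (λ a → indexOf a S) S ≡ upTo (length S)
indexOf-self [] [] = refl
indexOf-self (x ∷ S) (x∉S ∷ S-unique) with x ℕ.≟ x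
... | no x≢x = ⊥-elim (x≢x refl)
... | yes _  = cong (0 ∷_) (begin
  map (λ a → indexOf a (x ∷ S)) S        ≡⟨ List.map-cong-local (All.map (λ x≢a → indexOf-there S (x≢a ∘ sym)) x∉S) ⟩
  map (suc ∘ (λ a → indexOf a S)) S       ≡⟨ List.map-∘ S ⟩
  map suc (map (λ a → indexOf a S) S)     ≡⟨ cong (map suc) (indexOf-self S S-unique) ⟩
  map suc (upTo (length S))               ≡⟨ List.map-upTo suc (length S) ⟩
  applyUpTo suc (length S)                ∎)
  where open ≡-Reasoning

sorted-count : ∀ {a S} → AllPairs _<_ S → a ∈ S → length (filter (_<? a) S) ≡ indexOf a S
sorted-count {a} {x ∷ S} (x<S ∷ S-sorted) a∈ with a ℕ.≟ x
... | yes refl = cong length (trans (List.filter-reject (_<? a) (ℕ.<-irrefl refl))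
                                    (List.filter-none (_<? a) (All.map ℕ.<⇒≯ x<S)))
... | no a≢x   = trans (cong length (List.filter-accept (_<? a) (All.lookup x<S a∈S)))
                       (cong suc (sorted-count S-sorted a∈S))
  where
  a∈S : a ∈ S
  a∈S = Any.tail a≢x a∈

letters : Subst → Word
letters (ρ , σ) = ρ ++ σ

ren : (ℕ → ℕ) → Subst → Subst
ren h (ρ , σ) = (map h ρ , map h σ)

∈-letters-ren : ∀ {x} h p → x ∈ letters p → h x ∈ letters (ren h p)
∈-letters-ren h (ρ , σ) x∈ = subst (_ ∈_) (List.map-++ h ρ σ) (∈.∈-map⁺ h x∈)

-- canon p is definitionally ren (canonRenaming p) p.
canonRenaming : Subst → ℕ → ℕ
canonRenaming p a = indexOf a (deduplicate ℕ._≟_ (letters p))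

canon-ren : ∀ {h} p → InjectiveOn h (letters p) → canon (ren h p) ≡ canon p
canon-ren {h} p@(ρ , σ) inj = cong₂ _,_ (on ρ (⊆.xs⊆xs++ys ρ σ)) (on σ (⊆.xs⊆ys++xs σ ρ))
  where
  open ≡-Reasoning
  renaming-ren : ∀ {a} → a ∈ letters p → canonRenaming (ren h p) (h a) ≡ canonRenaming p a
  renaming-ren {a} a∈ = begin
    indexOf (h a) (deduplicate ℕ._≟_ (map h ρ ++ map h σ))
      ≡⟨ cong (indexOf (h a) ∘ deduplicate ℕ._≟_) (List.map-++ h ρ σ) ⟨
    indexOf (h a) (deduplicate ℕ._≟_ (map h (ρ ++ σ)))
      ≡⟨ cong (indexOf (h a)) (deduplicate-map inj) ⟩
    indexOf (h a) (map h (deduplicate ℕ._≟_ (ρ ++ σ)))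
      ≡⟨ indexOf-map (InjectiveOn-⊆ (λ { (here refl) → a∈ ; (there b∈) → ∈.∈-deduplicate⁻ ℕ._≟_ (ρ ++ σ) b∈ })
                                    inj) ⟩
    indexOf a (deduplicate ℕ._≟_ (ρ ++ σ)) ∎
  on : ∀ w → w ⊆ letters p → map (canonRenaming (ren h p)) (map h w) ≡ map (canonRenaming p) w
  on w w⊆ = trans (sym (List.map-∘ w)) (List.map-cong-local (All.tabulate (renaming-ren ∘ w⊆)))

canonRenaming-injective : ∀ p → InjectiveOn (canonRenaming p) (letters p)
canonRenaming-injective p a∈ b∈ =
  indexOf-injective (∈.∈-deduplicate⁺ ℕ._≟_ a∈) (∈.∈-deduplicate⁺ ℕ._≟_ b∈)

_~_ : Rel Subst 0ℓ
p ~ q = canon p ≡ canon q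

~-isEquivalence : IsEquivalence _~_
~-isEquivalence = record { refl = refl ; sym = sym ; trans = trans }

T-injective : ∀ {x y} → (T x → T y) → (T y → T x) → x ≡ y
T-injective {false} {false} _ _ = refl
T-injective {false} {true}  _ y⇒x = ⊥-elim (y⇒x _)
T-injective {true}  {false} x⇒y _ = ⊥-elim (x⇒y _)
T-injective {true}  {true}  _ _ = refl

wordEq-sound : ∀ {u v} → T (wordEq u v) → u ≡ v
wordEq-sound {u} {v} = toWitness {a? = List.≡-dec ℕ._≟_ u v}

wordEq-refl : ∀ u → T (wordEq u u)
wordEq-refl u = fromWitness {a? = List.≡-dec ℕ._≟_ u u} refl

substEq-sound : ∀ {p q} → T (substEq p q) → p ~ q
substEq-sound {p} {q} t with t₁ , t₂ ← Equivalence.to (T-∧ {wordEq (proj₁ (canon p)) _}) t =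
  cong₂ _,_ (wordEq-sound t₁) (wordEq-sound t₂)

substEq-refl : ∀ p → T (substEq p p)
substEq-refl p = Equivalence.from T-∧ (wordEq-refl (proj₁ (canon p)) , wordEq-refl (proj₂ (canon p)))

substEq-resp : ∀ s {p q} → p ~ q → substEq s p ≡ substEq s q
substEq-resp s = cong (λ c → wordEq (proj₁ (canon s)) (proj₁ c) ∧ wordEq (proj₂ (canon s)) (proj₂ c))

_≃_ : Rel dWHA 0ℓ
_≃_ = Termwise _~_

≃-setoid : Setoid 0ℓ 0ℓ
≃-setoid = record { isEquivalence = Termwise-isEquivalence ~-isEquivalence }

module ≃-Reasoning = Relation.Binary.Reasoning.Setoid ≃-setoid

≃-sym : ∀ {A B} → A ≃ B → B ≃ A
≃-sym = Setoid.sym ≃-setoid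

basis⁺ : ∀ {p q} → p ~ q → basis p ≃ basis q
basis⁺ p~q = (refl , p~q) ∷ []

≃⇒≈D : ∀ {A B} → A ≃ B → A ≈D B
≃⇒≈D = Termwise⇒Eq substEq substEq-resp

≤-maxLetter : ∀ {x l} → x ∈ l → x ≤ maxLetter l
≤-maxLetter {l = y ∷ l} (here refl) = ℕ.m≤m⊔n y (maxLetter l)
≤-maxLetter {l = y ∷ l} (there x∈) = ℕ.≤-trans (≤-maxLetter x∈) (ℕ.m≤n⊔m y (maxLetter l))

offset : Subst → ℕ
offset (ρ , σ) = suc (maxLetter ρ ⊔ maxLetter σ)

<-offset : ∀ {x} p → x ∈ letters p → x < offset p
<-offset (ρ , σ) x∈ with ∈.∈-++⁻ ρ x∈
... | inj₁ x∈ρ = s≤s (ℕ.≤-trans (≤-maxLetter x∈ρ) (ℕ.m≤m⊔n _ _))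
... | inj₂ x∈σ = s≤s (ℕ.≤-trans (≤-maxLetter x∈σ) (ℕ.m≤n⊔m _ _))

-- mulDb p q is definitionally mulDbAt (offset p) p q.
mulDbAt : ℕ → Subst → Subst → dWHA
mulDbAt k (ρ , σ) (ρ′ , σ′) = map (λ γ → (+ 1 , (ρ ++ shift k ρ′ , γ))) (shuffle σ (shift k σ′))

-- The renaming of a product term induced by renaming the left factor by h and the right one by g.
glue : ℕ → ℕ → (ℕ → ℕ) → (ℕ → ℕ) → ℕ → ℕ
glue k k′ h g x with x <? k
... | yes _ = h x
... | no  _ = k′ ℕ.+ g (x ∸ k)

glue-< : ∀ {k k′ h g x} → x < k → glue k k′ h g x ≡ h x
glue-< {k} {x = x} x<k with x <? k
... | yes _   = refl
... | no x≮k = ⊥-elim (x≮k x<k)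

glue-+ : ∀ k {k′ h g} y → glue k k′ h g (k ℕ.+ y) ≡ k′ ℕ.+ g y
glue-+ k {k′} {g = g} y with k ℕ.+ y <? k
... | yes k+y<k = ⊥-elim (ℕ.m+n≮m k y k+y<k)
... | no _      = cong (λ z → k′ ℕ.+ g z) (ℕ.m+n∸m≡n k y)

module _ {k k′ : ℕ} {h g : ℕ → ℕ} {l m : List ℕ}
         (bounds : ∀ {x} → x ∈ l → x < k × h x < k′) (h-inj : InjectiveOn h l) (g-inj : InjectiveOn g m) where

  private
    glue-lo≢hi : ∀ {x} → x ∈ l → ∀ y → glue k k′ h g x ≢ glue k k′ h g (k ℕ.+ y)
    glue-lo≢hi {x} x∈ y eq = ℕ.m+n≮m k′ (g y)
      (subst (_< k′) (trans (sym (glue-< (proj₁ (bounds x∈)))) (trans eq (glue-+ k y))) (proj₂ (bounds x∈)))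

  glue-injectiveOn : InjectiveOn (glue k k′ h g) (l ++ shift k m)
  glue-injectiveOn a∈ b∈ eq with ∈.∈-++⁻ l a∈ | ∈.∈-++⁻ l b∈
  ... | inj₁ a∈l | inj₁ b∈l =
    h-inj a∈l b∈l (trans (sym (glue-< (proj₁ (bounds a∈l)))) (trans eq (glue-< (proj₁ (bounds b∈l)))))
  ... | inj₁ a∈l | inj₂ b∈km with _ , _ , refl ← ∈.∈-map⁻ _ b∈km = ⊥-elim (glue-lo≢hi a∈l _ eq)
  ... | inj₂ a∈km | inj₁ b∈l with _ , _ , refl ← ∈.∈-map⁻ _ a∈km = ⊥-elim (glue-lo≢hi b∈l _ (sym eq))
  ... | inj₂ a∈km | inj₂ b∈km with y , y∈ , refl ← ∈.∈-map⁻ _ a∈km | z , z∈ , refl ← ∈.∈-map⁻ _ b∈km =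
    cong (k ℕ.+_) (g-inj y∈ z∈ (ℕ.+-cancelˡ-≡ k′ _ _ (trans (sym (glue-+ k y)) (trans eq (glue-+ k z)))))

mulDbAt-ren : ∀ {k k′ h g} p q → (∀ {x} → x ∈ letters p → x < k × h x < k′) →
              InjectiveOn h (letters p) → InjectiveOn g (letters q) →
              mulDbAt k p q ≃ mulDbAt k′ (ren h p) (ren g q)
mulDbAt-ren {k} {k′} {h} {g} p@(ρ , σ) q@(ρ′ , σ′) bounds h-inj g-inj = begin
  map (λ γ → (+ 1 , (R , γ))) S
    ≈⟨ map⁺-All (λ γ↭ → refl , sym (canon-ren (R , _) (H-inj γ↭))) (shuffle-↭ σ (shift k σ′)) ⟩
  map (λ γ → (+ 1 , (map H R , map H γ))) S
    ≡⟨ List.map-∘ S ⟩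
  map (λ γ → (+ 1 , (map H R , γ))) (map (map H) S)
    ≡⟨ cong₂ (λ R′ S′ → map (λ γ → (+ 1 , (R′ , γ))) S′) R-ren S-ren ⟩
  mulDbAt k′ (ren h p) (ren g q) ∎
  where
  open ≃-Reasoning
  H : ℕ → ℕ
  H = glue k k′ h g
  R : Word
  R = ρ ++ shift k ρ′
  S : List Word
  S = shuffle σ (shift k σ′)
  L : Word
  L = letters p ++ shift k (letters q)
  p⊆L : letters p ⊆ L
  p⊆L = ⊆.xs⊆xs++ys _ _
  shift⊆L : ∀ {w} → w ⊆ letters q → shift k w ⊆ L
  shift⊆L w⊆ = ⊆.⊆-trans (⊆.map⁺ (k ℕ.+_) w⊆) (⊆.xs⊆ys++xs _ (letters p))
  H-inj : ∀ {γ} → γ ↭ σ ++ shift k σ′ → InjectiveOn H (R ++ γ)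
  H-inj γ↭ = InjectiveOn-⊆
    (++-⊆ (++-⊆ (⊆.⊆-trans (⊆.xs⊆xs++ys ρ σ) p⊆L) (shift⊆L (⊆.xs⊆xs++ys ρ′ σ′)))
          (⊆.⊆-trans (⊆.⊆-reflexive-↭ γ↭)
                     (++-⊆ (⊆.⊆-trans (⊆.xs⊆ys++xs σ ρ) p⊆L) (shift⊆L (⊆.xs⊆ys++xs σ′ ρ′)))))
    (glue-injectiveOn bounds h-inj g-inj)
  H-lo : ∀ w → w ⊆ letters p → map H w ≡ map h w
  H-lo w w⊆ = List.map-cong-local (All.tabulate (λ x∈ → glue-< (proj₁ (bounds (w⊆ x∈)))))
  H-hi : ∀ w → map H (shift k w) ≡ shift k′ (map g w)
  H-hi w = trans (sym (List.map-∘ w)) (trans (List.map-cong (glue-+ k) w) (List.map-∘ w))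
  R-ren : map H R ≡ map h ρ ++ shift k′ (map g ρ′)
  R-ren = trans (List.map-++ H ρ (shift k ρ′)) (cong₂ _++_ (H-lo ρ (⊆.xs⊆xs++ys ρ σ)) (H-hi ρ′))
  S-ren : map (map H) S ≡ shuffle (map h σ) (shift k′ (map g σ′))
  S-ren = trans (sym (shuffle-map H σ (shift k σ′))) (cong₂ shuffle (H-lo σ (⊆.xs⊆ys++xs σ ρ)) (H-hi σ′))

mulDb-canon : ∀ p q → mulDb p q ≃ mulDb (canon p) (canon q)
mulDb-canon p q = mulDbAt-ren p q
  (λ x∈ → <-offset p x∈ , <-offset (canon p) (∈-letters-ren (canonRenaming p) p x∈))
  (canonRenaming-injective p) (canonRenaming-injective q)

mulDb-cong : ∀ {p p′ q q′} → p ~ p′ → q ~ q′ → mulDb p q ≃ mulDb p′ q′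
mulDb-cong {p} {p′} {q} {q′} p~p′ q~q′ = begin
  mulDb p q                  ≈⟨ mulDb-canon p q ⟩
  mulDb (canon p) (canon q)   ≡⟨ cong₂ mulDb p~p′ q~q′ ⟩
  mulDb (canon p′) (canon q′) ≈⟨ ≃-sym (mulDb-canon p′ q′) ⟩
  mulDb p′ q′                ∎
  where open ≃-Reasoning

mulD-cong : ∀ {A A′ B B′} → A ≃ A′ → B ≃ B′ → mulD A B ≃ mulD A′ B′
mulD-cong {A} {A′} {B} {B′} A≃A′ B≃B′ = begin
  mulD A B                         ≡⟨ bilin-lin mulDb A B ⟩
  lin (λ p → lin (mulDb p) B) A    ≈⟨ lin⁺ (λ p~p′ → lin⁺ (mulDb-cong p~p′) B≃B′) A≃A′ ⟩
  lin (λ p → lin (mulDb p) B′) A′  ≡⟨ bilin-lin mulDb A′ B′ ⟨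
  mulD A′ B′                       ∎
  where open ≃-Reasoning

disjoint-ren : ∀ {h} u v → InjectiveOn h (u ++ v) → disjoint (map h u) (map h v) ≡ disjoint u v
disjoint-ren [] v inj = refl
disjoint-ren {h} (a ∷ u) v inj = cong₂ _∧_
  (cong (λ b → if b then false else true) (begin
    isYes (h a ∈? map h v)  ≡⟨ isYes≗does _ ⟩
    does (h a ∈? map h v)   ≡⟨ does-⇔ ha∈⇔a∈ (h a ∈? map h v) (a ∈? v) ⟩
    does (a ∈? v)           ≡⟨ isYes≗does _ ⟨
    isYes (a ∈? v)          ∎))
  (disjoint-ren u v (InjectiveOn-⊆ there inj))
  where
  open ≡-Reasoning
  ha∈⇔a∈ : h a ∈ map h v ⇔ a ∈ v
  ha∈⇔a∈ = ∈-map-injectiveOn (InjectiveOn-⊆ (⊆.++⁺ʳ (a ∷ []) (⊆.xs⊆ys++xs v u)) inj)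

goodCuts-ren : ∀ {h} σ L → InjectiveOn h σ → goodCuts (map h σ) L ≡ goodCuts σ L
goodCuts-ren {h} σ L inj = List.filter-≐ _ _ ((λ {k} eq → trans (sym (same k)) eq) , (λ {k} eq → trans (same k) eq)) L
  where
  same : ∀ k → disjoint (take k (map h σ)) (drop k (map h σ)) ≡ disjoint (take k σ) (drop k σ)
  same k = trans (cong₂ disjoint (List.take-map k σ) (List.drop-map k σ))
                 (disjoint-ren (take k σ) (drop k σ) (InjectiveOn-⊆ (⊆.⊆-reflexive (List.take++drop≡id k σ)) inj))

properCutPoints-map : ∀ h σ → properCutPoints (map h σ) ≡ properCutPoints σ
properCutPoints-map h σ rewrite List.length-map h σ = refl

preimage-ren : ∀ {h} ρ τ → InjectiveOn h (ρ ++ τ) → preimage (map h ρ) (map h τ) ≡ map h (preimage ρ τ)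
preimage-ren {h} ρ τ inj = filter-map (_∈? map h τ) (_∈? τ) h {ρ}
  (λ a∈ρ → ∈-map-injectiveOn (InjectiveOn-⊆ (λ { (here refl) → ∈.∈-++⁺ˡ a∈ρ ; (there b∈) → ∈.∈-++⁺ʳ ρ b∈ }) inj))

letters-cut₁-⊆ : ∀ p k → letters (proj₁ (cutSubst p k)) ⊆ letters p
letters-cut₁-⊆ (ρ , σ) k = ⊆.++⁺ (⊆.filter-⊆ _ ρ) (take-⊆ k σ)

letters-cut₂-⊆ : ∀ p k → letters (proj₂ (cutSubst p k)) ⊆ letters p
letters-cut₂-⊆ (ρ , σ) k = ⊆.++⁺ (⊆.filter-⊆ _ ρ) (drop-⊆ k σ)

cutSubst-ren : ∀ {h} p k → InjectiveOn h (letters p) →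
               cutSubst (ren h p) k ≡ (ren h (proj₁ (cutSubst p k)) , ren h (proj₂ (cutSubst p k)))
cutSubst-ren {h} (ρ , σ) k inj = cong₂ _,_ (part (take-⊆ k σ) (List.take-map k σ)) (part (drop-⊆ k σ) (List.drop-map k σ))
  where
  part : ∀ {τ τ′} → τ ⊆ σ → τ′ ≡ map h τ → (preimage (map h ρ) τ′ , τ′) ≡ ren h (preimage ρ τ , τ)
  part {τ} τ⊆σ refl = cong (_, map h τ) (preimage-ren ρ τ (InjectiveOn-⊆ (⊆.++⁺ʳ ρ τ⊆σ) inj))

SDb-ren : ∀ m {h} p → InjectiveOn h (letters p) → SDb-fuel m p ≃ SDb-fuel m (ren h p)
SDb-ren m       (ρ , [])    inj = basis⁺ (sym (canon-ren (ρ , []) inj))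
SDb-ren zero    (ρ , _ ∷ _) inj = []
SDb-ren (suc m) {h} p@(ρ , σ@(_ ∷ _)) inj =
  scale⁺ (- (+ 1)) (Pointwise.++⁺ (basis⁺ (sym (canon-ren p inj))) (begin
    concatMap (term p) (goodCuts σ (properCutPoints σ))
      ≈⟨ concatMap⁺ term-ren (goodCuts σ (properCutPoints σ)) ⟩
    concatMap (term (ren h p)) (goodCuts σ (properCutPoints σ))
      ≡⟨ cong (concatMap (term (ren h p))) cuts-ren ⟨
    concatMap (term (ren h p)) (goodCuts (map h σ) (properCutPoints (map h σ))) ∎))
  where
  open ≃-Reasoning
  term : Subst → ℕ → dWHA
  term q k = mulD (SDb-fuel m (proj₁ (cutSubst q k))) (basis (proj₂ (cutSubst q k)))
  cuts-ren : goodCuts (map h σ) (properCutPoints (map h σ)) ≡ goodCuts σ (properCutPoints σ)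
  cuts-ren = trans (goodCuts-ren σ (properCutPoints (map h σ)) (InjectiveOn-⊆ (⊆.xs⊆ys++xs σ ρ) inj))
                   (cong (goodCuts σ) (properCutPoints-map h σ))
  term-ren : ∀ k → term p k ≃ term (ren h p) k
  term-ren k = begin
    term p k
      ≈⟨ mulD-cong (SDb-ren m (proj₁ (cutSubst p k)) (InjectiveOn-⊆ (letters-cut₁-⊆ p k) inj))
                   (basis⁺ (sym (canon-ren (proj₂ (cutSubst p k)) (InjectiveOn-⊆ (letters-cut₂-⊆ p k) inj)))) ⟩
    mulD (SDb-fuel m (ren h (proj₁ (cutSubst p k)))) (basis (ren h (proj₂ (cutSubst p k))))
      ≡⟨ cong (λ c → mulD (SDb-fuel m (proj₁ c)) (basis (proj₂ c))) (cutSubst-ren p k inj) ⟨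
    term (ren h p) k ∎

SDb-cong : ∀ m {p q} → p ~ q → SDb-fuel m p ≃ SDb-fuel m q
SDb-cong m {p} {q} p~q = begin
  SDb-fuel m p          ≈⟨ SDb-ren m p (canonRenaming-injective p) ⟩
  SDb-fuel m (canon p)  ≡⟨ cong (SDb-fuel m) p~q ⟩
  SDb-fuel m (canon q)  ≈⟨ ≃-sym (SDb-ren m q (canonRenaming-injective q)) ⟩
  SDb-fuel m q          ∎
  where open ≃-Reasoning

-- Permutation words and standardisation

oneTo : ℕ → Word
oneTo n = map suc (upTo n)

∈-oneTo⁺ : ∀ {a n} → 1 ≤ a → a ≤ n → a ∈ oneTo n
∈-oneTo⁺ {suc a} (s≤s z≤n) a≤n = ∈.∈-map⁺ suc (∈.∈-upTo⁺ a≤n)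

∈-oneTo⁻ : ∀ {a n} → a ∈ oneTo n → 1 ≤ a × a ≤ n
∈-oneTo⁻ a∈ with _ , i∈ , refl ← ∈.∈-map⁻ suc a∈ = s≤s z≤n , ∈.∈-upTo⁻ i∈

length-oneTo : ∀ n → length (oneTo n) ≡ n
length-oneTo n = trans (List.length-map suc (upTo n)) (List.length-upTo n)

length-map-oneTo : ∀ (f : ℕ → ℕ) n → length (map f (oneTo n)) ≡ n
length-map-oneTo f n = trans (List.length-map f (oneTo n)) (length-oneTo n)

oneTo-+ : ∀ n m → oneTo (n ℕ.+ m) ≡ oneTo n ++ shift n (oneTo m)
oneTo-+ n m = begin
  map suc (upTo (n ℕ.+ m))                         ≡⟨ List.map-upTo suc (n ℕ.+ m) ⟩
  applyUpTo suc (n ℕ.+ m)                          ≡⟨ applyUpTo-+ suc n m ⟩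
  applyUpTo suc n ++ applyUpTo (suc ∘ (n ℕ.+_)) m  ≡⟨ cong₂ _++_ (List.map-upTo suc n) (List.map-upTo _ m) ⟨
  oneTo n ++ map (suc ∘ (n ℕ.+_)) (upTo m)         ≡⟨ cong (oneTo n ++_) (List.map-cong (λ i → sym (ℕ.+-suc n i)) (upTo m)) ⟩
  oneTo n ++ map ((n ℕ.+_) ∘ suc) (upTo m)         ≡⟨ cong (oneTo n ++_) (List.map-∘ (upTo m)) ⟩
  oneTo n ++ shift n (oneTo m)                     ∎
  where open ≡-Reasoning

oneTo-sorted : ∀ n → AllPairs _<_ (oneTo n)
oneTo-sorted n = AllPairs.map⁺ (AllPairs.applyUpTo⁺₁ (λ i → i) n (λ i<j _ → s≤s i<j))

oneTo-isPerm : ∀ n → IsPerm (oneTo n)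
oneTo-isPerm n = AllPairs.map ℕ.<⇒≢ (oneTo-sorted n) ,
  All.tabulate (λ a∈ → subst (λ m → 1 ≤ _ × _ ≤ m) (sym (length-oneTo n)) (∈-oneTo⁻ a∈))

positive : ∀ {w} → IsPerm w → All (1 ≤_) w
positive (_ , range) = All.map proj₁ range

IsPerm-resp-↭ : ∀ {w w′} → w ↭ w′ → IsPerm w′ → IsPerm w
IsPerm-resp-↭ {w} {w′} w↭w′ (unique , range) =
  ↭ₛ.Unique-resp-↭ (≡.setoid ℕ) (↭⇒↭ₛ (↭-sym w↭w′)) unique ,
  ↭.All-resp-↭ (↭-sym w↭w′) (subst (λ m → All (λ a → 1 ≤ a × a ≤ m) w′) (sym (↭.↭-length w↭w′)) range)

IsPerm⇒⊆oneTo : ∀ {w} → IsPerm w → w ⊆ oneTo (length w)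
IsPerm⇒⊆oneTo (_ , range) a∈ = let (1≤a , a≤n) = All.lookup range a∈ in ∈-oneTo⁺ 1≤a a≤n

length-++-shift : ∀ a b → length (a ++ shift (length a) b) ≡ length a ℕ.+ length b
length-++-shift a b = trans (List.length-++ a) (cong (length a ℕ.+_) (List.length-map (length a ℕ.+_) b))

IsPerm-++-shift : ∀ {a b} → IsPerm a → IsPerm b → IsPerm (a ++ shift (length a) b)
IsPerm-++-shift {a} {b} (a-unique , a-range) b-perm@(b-unique , b-range) =
  Unique.++⁺ a-unique (Unique.map⁺ (ℕ.+-cancelˡ-≡ n _ _) b-unique) a∩b=∅ ,
  subst (λ l → All (λ x → 1 ≤ x × x ≤ l) (a ++ shift n b)) (sym (length-++-shift a b))
        (All.++⁺ (All.map (λ { (1≤x , x≤n) → 1≤x , ℕ.≤-trans x≤n (ℕ.m≤m+n n m) }) a-range)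
                 (All.map⁺ (All.map (λ { (1≤y , y≤m) → ℕ.≤-trans 1≤y (ℕ.m≤n+m _ n) , ℕ.+-monoʳ-≤ n y≤m }) b-range)))
  where
  n m : ℕ
  n = length a
  m = length b
  a∩b=∅ : ∀ {x} → x ∈ a × x ∈ shift n b → ⊥
  a∩b=∅ (x∈a , x∈b) with y , y∈b , refl ← ∈.∈-map⁻ (n ℕ.+_) x∈b =
    ℕ.<⇒≱ (ℕ.m<m+n n (All.lookup (positive b-perm) y∈b)) (proj₂ (All.lookup a-range x∈a))

module Standardisation {n : ℕ} {u : Word} (u-unique : Unique u) (u⊆oneTo : u ⊆ oneTo n) where

  support : Word
  support = preimage (oneTo n) u

  support-sorted : AllPairs _<_ support
  support-sorted = AllPairs.filter⁺ (_∈? u) (oneTo-sorted n)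

  support-unique : Unique support
  support-unique = AllPairs.map ℕ.<⇒≢ support-sorted

  support⊆u : support ⊆ u
  support⊆u a∈ = proj₂ (∈.∈-filter⁻ (_∈? u) {xs = oneTo n} a∈)

  u⊆support : u ⊆ support
  u⊆support a∈ = ∈.∈-filter⁺ (_∈? u) (u⊆oneTo a∈) a∈

  u↭support : u ↭ support
  u↭support = ∼bag⇒↭ (unique∧set⇒bag u-unique support-unique (mk⇔ u⊆support support⊆u))

  -- st u is definitionally map rank u.
  rank : ℕ → ℕ
  rank a = suc (length (filter (_<? a) u))

  rank-index : ∀ {a} → a ∈ support → rank a ≡ suc (indexOf a support)
  rank-index {a} a∈ = cong suc (trans (↭.↭-length (↭.filter-↭ (_<? a) u↭support)) (sorted-count support-sorted a∈))

  rank-support : map rank support ≡ oneTo (length u)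
  rank-support = begin
    map rank support                                ≡⟨ List.map-cong-local (All.tabulate rank-index) ⟩
    map (suc ∘ (λ a → indexOf a support)) support   ≡⟨ List.map-∘ support ⟩
    map suc (map (λ a → indexOf a support) support) ≡⟨ cong (map suc) (indexOf-self support support-unique) ⟩
    oneTo (length support)                          ≡⟨ cong oneTo (↭.↭-length u↭support) ⟨
    oneTo (length u)                                ∎
    where open ≡-Reasoning

  rank-injective : InjectiveOn rank (support ++ u)
  rank-injective a∈ b∈ eq =
    indexOf-injective (in-support a∈) (in-support b∈)
                      (ℕ.suc-injective (trans (sym (rank-index (in-support a∈))) (trans eq (rank-index (in-support b∈)))))
    where
    in-support : support ++ u ⊆ support
    in-support = ++-⊆ (λ a∈ → a∈) u⊆support

  st-↭ : st u ↭ oneTo (length u)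
  st-↭ = subst (st u ↭_) rank-support (↭.map⁺ rank u↭support)

  st-isPerm : IsPerm (st u)
  st-isPerm = IsPerm-resp-↭ st-↭ (oneTo-isPerm (length u))

  support~st : (support , u) ~ φb (st u)
  support~st = begin
    canon (support , u)                    ≡⟨ canon-ren (support , u) rank-injective ⟨
    canon (map rank support , st u)        ≡⟨ cong (λ ρ → canon (ρ , st u)) rank-support ⟩
    canon (oneTo (length u) , st u)        ≡⟨ cong (λ m → canon (oneTo m , st u)) (List.length-map rank u) ⟨
    canon (oneTo (length (st u)) , st u)   ∎
    where open ≡-Reasoning

module CutOfPerm {w : Word} (w-perm : IsPerm w) (k : ℕ) where
  module Left = Standardisation (Unique.take⁺ k (proj₁ w-perm)) (⊆.⊆-trans (take-⊆ k w) (IsPerm⇒⊆oneTo w-perm))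
  module Right = Standardisation (Unique.drop⁺ k (proj₁ w-perm)) (⊆.⊆-trans (drop-⊆ k w) (IsPerm⇒⊆oneTo w-perm))

disjoint-true : ∀ {u v} → (∀ {a} → a ∈ u → a ∈ v → ⊥) → disjoint u v ≡ true
disjoint-true {[]} _ = refl
disjoint-true {a ∷ u} {v} u∩v=∅ with a ∈? v
... | yes a∈v = ⊥-elim (u∩v=∅ (here refl) a∈v)
... | no _    = disjoint-true (u∩v=∅ ∘ there)

goodCuts-unique : ∀ {w} L → Unique w → goodCuts w L ≡ L
goodCuts-unique {w} L w-unique = List.filter-all _ (All.universal (λ k → disjoint-true (cut-disjoint k)) L)
  where
  cut-disjoint : ∀ k {a} → a ∈ take k w → a ∈ drop k w → ⊥
  cut-disjoint k = unique-++-disjoint (take k w) (subst Unique (sym (List.take++drop≡id k w)) w-unique)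

mulMb-isPerm : ∀ {a b} → IsPerm a → IsPerm b → InMPR (mulMb a b)
mulMb-isPerm {a} {b} a-perm b-perm =
  All.map⁺ (All.map (λ γ↭ → IsPerm-resp-↭ γ↭ (IsPerm-++-shift a-perm b-perm)) (shuffle-↭ a (shift (length a) b)))

mulM-isPerm : ∀ {x y} → InMPR x → InMPR y → InMPR (mulM x y)
mulM-isPerm {x} {y} x-perm y-perm =
  subst InMPR (sym (bilin-lin mulMb x y)) (lin-All (λ a-perm → lin-All (mulMb-isPerm a-perm) y-perm) x-perm)

SMb-isPerm : ∀ m {w} → IsPerm w → InMPR (SMb-fuel m w)
SMb-isPerm m       {[]}    _ = ([] , []) ∷ []
SMb-isPerm zero    {_ ∷ _} _ = []
SMb-isPerm (suc m) {w@(_ ∷ _)} w-perm = scale-All (- (+ 1)) (All.++⁺ (w-perm ∷ [])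
  (concatMap-All (λ k → mulM-isPerm (SMb-isPerm m (CutOfPerm.Left.st-isPerm w-perm k))
                                     (CutOfPerm.Right.st-isPerm w-perm k ∷ []))
                 (properCutPoints w)))

-- φ preserves the structure

shift-suc-pred : ∀ n {w} → All (1 ≤_) w → shift (suc n) (map pred w) ≡ shift n w
shift-suc-pred n {w} w-pos =
  trans (sym (List.map-∘ w)) (List.map-cong-local (All.map (λ { (s≤s z≤n) → sym (ℕ.+-suc n _) }) w-pos))

suc-pred : ∀ {w} → All (1 ≤_) w → map suc (map pred w) ≡ w
suc-pred {w} w-pos =
  trans (sym (List.map-∘ w)) (trans (List.map-cong-local (All.map (λ { (s≤s z≤n) → refl }) w-pos)) (List.map-id w))

ren-id : ∀ p → ren (λ x → x) p ≡ p
ren-id (ρ , σ) = cong₂ _,_ (List.map-id ρ) (List.map-id σ)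

-- MPR shifts b by n = length a, dWHA by offset (φb a).  Renaming b by pred turns the MPR product
-- into one shifted by suc n, a bound for the letters of φb a, so mulDbAt-ren applies with g = suc.
φb-mul : ∀ {a b} → IsPerm a → IsPerm b → φ (mulMb a b) ≃ mulDb (φb a) (φb b)
φb-mul {a} {b} a-perm b-perm = begin
  φ (mulMb a b)
    ≡⟨ lin-basis-map φb (map (+ 1 ,_) S) ⟩
  map (map₂ φb) (map (+ 1 ,_) S)
    ≡⟨ List.map-∘ S ⟨
  map (λ γ → (+ 1 , (oneTo (length γ) , γ))) S
    ≡⟨ List.map-cong-local (All.map (λ {γ} γ↭ → cong (λ l → (+ 1 , (oneTo l , γ))) (length-shuffle γ↭))
                                    (shuffle-↭ a (shift n b))) ⟩
  map (λ γ → (+ 1 , (oneTo (n ℕ.+ m) , γ))) S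
    ≡⟨ cong₂ (λ R S′ → map (λ γ → (+ 1 , (R , γ))) S′) R-split S-split ⟩
  mulDbAt (suc n) (φb a) (ren pred (φb b))
    ≈⟨ mulDbAt-ren (φb a) (ren pred (φb b)) bounds (λ _ _ eq → eq) (λ _ _ → ℕ.suc-injective) ⟩
  mulDbAt (offset (φb a)) (ren (λ x → x) (φb a)) (ren suc (ren pred (φb b)))
    ≡⟨ cong₂ (mulDbAt (offset (φb a))) (ren-id (φb a))
             (cong₂ _,_ (suc-pred (positive (oneTo-isPerm m))) (suc-pred (positive b-perm))) ⟩
  mulDb (φb a) (φb b) ∎
  where
  open ≃-Reasoning
  n m : ℕ
  n = length a
  m = length b
  S : List Word
  S = shuffle a (shift n b)
  length-shuffle : ∀ {γ} → γ ↭ a ++ shift n b → length γ ≡ n ℕ.+ m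
  length-shuffle γ↭ = trans (↭.↭-length γ↭) (length-++-shift a b)
  R-split : oneTo (n ℕ.+ m) ≡ oneTo n ++ shift (suc n) (map pred (oneTo m))
  R-split = trans (oneTo-+ n m) (cong (oneTo n ++_) (sym (shift-suc-pred n (positive (oneTo-isPerm m)))))
  S-split : S ≡ shuffle a (shift (suc n) (map pred b))
  S-split = cong (shuffle a) (sym (shift-suc-pred n (positive b-perm)))
  bounds : ∀ {x} → x ∈ letters (φb a) → x < suc n × x < offset (φb a)
  bounds {x} x∈ = s≤s (≤n (∈.∈-++⁻ (oneTo n) x∈)) , <-offset (φb a) x∈
    where
    ≤n : x ∈ oneTo n ⊎ x ∈ a → x ≤ n
    ≤n (inj₁ x∈oneTo) = proj₂ (∈-oneTo⁻ x∈oneTo)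
    ≤n (inj₂ x∈a) = proj₂ (All.lookup (proj₂ a-perm) x∈a)

φ-mulM : ∀ {x y} → InMPR x → InMPR y → φ (mulM x y) ≃ mulD (φ x) (φ y)
φ-mulM {x} {y} x-perm y-perm = begin
  φ (mulM x y)                                      ≡⟨ cong φ (bilin-lin mulMb x y) ⟩
  φ (lin (λ a → lin (mulMb a) y) x)                 ≡⟨ lin-lin (basis ∘ φb) _ x ⟩
  lin (λ a → φ (lin (mulMb a) y)) x                 ≡⟨ lin-cong (λ a → lin-lin (basis ∘ φb) (mulMb a) y) x ⟩
  lin (λ a → lin (λ b → φ (mulMb a b)) y) x         ≈⟨ lin⁺-All (λ a-perm → lin⁺-All (φb-mul a-perm) y-perm) x-perm ⟩
  lin (λ a → lin (λ b → mulDb (φb a) (φb b)) y) x   ≡⟨ lin-cong (λ a → lin-lin-basis (mulDb (φb a)) φb y) x ⟨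
  lin (λ a → lin (mulDb (φb a)) (φ y)) x            ≡⟨ lin-lin-basis (λ p → lin (mulDb p) (φ y)) φb x ⟨
  lin (λ p → lin (mulDb p) (φ y)) (φ x)             ≡⟨ bilin-lin mulDb (φ x) (φ y) ⟨
  mulD (φ x) (φ y)                                  ∎
  where open ≃-Reasoning

φb-antipode : ∀ m {w} → IsPerm w → φ (SMb-fuel m w) ≃ SDb-fuel m (φb w)
φb-antipode m       {[]}    _ = basis⁺ refl
φb-antipode zero    {_ ∷ _} _ = []
φb-antipode (suc m) {w@(_ ∷ _)} w-perm = begin
  φ (neg (basis w ++ concatMap term P))
    ≡⟨ lin-scale (basis ∘ φb) (- (+ 1)) (basis w ++ concatMap term P) ⟩
  neg (φ (basis w ++ concatMap term P))
    ≡⟨ cong neg (trans (lin-++ (basis ∘ φb) (basis w) (concatMap term P))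
                       (cong (basis (φb w) ++_) (lin-concatMap (basis ∘ φb) term P))) ⟩
  neg (basis (φb w) ++ concatMap (φ ∘ term) P)
    ≈⟨ scale⁺ (- (+ 1)) (Pointwise.++⁺ (basis⁺ refl) (concatMap⁺ term-φ P)) ⟩
  neg (basis (φb w) ++ concatMap term′ P)
    ≡⟨ cong (λ L → neg (basis (φb w) ++ concatMap term′ L)) (goodCuts-unique P (proj₁ w-perm)) ⟨
  SDb-fuel (suc m) (φb w) ∎
  where
  open ≃-Reasoning
  P : List ℕ
  P = properCutPoints w
  term : ℕ → MPR
  term k = mulM (SMb-fuel m (st (take k w))) (basis (st (drop k w)))
  term′ : ℕ → dWHA
  term′ k = mulD (SDb-fuel m (proj₁ (cutSubst (φb w) k))) (basis (proj₂ (cutSubst (φb w) k)))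
  term-φ : ∀ k → φ (term k) ≃ term′ k
  term-φ k = begin
    φ (term k)
      ≈⟨ φ-mulM (SMb-isPerm m Left.st-isPerm) (Right.st-isPerm ∷ []) ⟩
    mulD (φ (SMb-fuel m (st (take k w)))) (basis (φb (st (drop k w))))
      ≈⟨ mulD-cong (φb-antipode m Left.st-isPerm) (basis⁺ refl) ⟩
    mulD (SDb-fuel m (φb (st (take k w)))) (basis (φb (st (drop k w))))
      ≈⟨ mulD-cong (SDb-cong m (sym Left.support~st)) (basis⁺ (sym Right.support~st)) ⟩
    term′ k ∎
    where open CutOfPerm w-perm k

φ-antipode : ∀ {x} → InMPR x → φ (SM x) ≃ SD (φ x)
φ-antipode {x} x-perm = begin
  φ (SM x)                                    ≡⟨ lin-lin (basis ∘ φb) _ x ⟩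
  lin (λ w → φ (SMb-fuel (length w) w)) x     ≈⟨ lin⁺-All (λ {w} → φb-antipode (length w)) x-perm ⟩
  lin (λ w → SDb-fuel (length w) (φb w)) x    ≡⟨ lin-lin-basis _ φb x ⟨
  SD (φ x)                                    ∎
  where open ≃-Reasoning

_≃²_ : Rel dWHA⊗dWHA 0ℓ
_≃²_ = Termwise (×.Pointwise _~_ _~_)

≃²-setoid : Setoid 0ℓ 0ℓ
≃²-setoid = record { isEquivalence = Termwise-isEquivalence (×.×-isEquivalence ~-isEquivalence ~-isEquivalence) }

module ≃²-Reasoning = Relation.Binary.Reasoning.Setoid ≃²-setoid

≃²⇒≈DD : ∀ {A B} → A ≃² B → A ≈DD B
≃²⇒≈DD = Termwise⇒Eq _ (λ { (s , t) (p~p′ , q~q′) → cong₂ _∧_ (substEq-resp s p~p′) (substEq-resp t q~q′) })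

φ² : Word × Word → Subst × Subst
φ² (u , v) = (φb u , φb v)

φb-coproduct : ∀ {w} → IsPerm w → lin (basis ∘ φ²) (ΔMb w) ≃² ΔDb (φb w)
φb-coproduct {w} w-perm = begin
  lin (basis ∘ φ²) (map cutM (cutPoints w))
    ≡⟨ lin-basis-map φ² (map cutM (cutPoints w)) ⟩
  map (map₂ φ²) (map cutM (cutPoints w))
    ≡⟨ List.map-∘ (cutPoints w) ⟨
  map (map₂ φ² ∘ cutM) (cutPoints w)
    ≈⟨ Pointwise.map⁺ (map₂ φ² ∘ cutM) cutD (Pointwise.refl (λ {k} → cut-φ k) {cutPoints w}) ⟩
  map cutD (cutPoints w)
    ≡⟨ cong (map cutD) (goodCuts-unique (cutPoints w) (proj₁ w-perm)) ⟨
  ΔDb (φb w) ∎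
  where
  open ≃²-Reasoning
  cutM : ℕ → ℤ × (Word × Word)
  cutM k = (+ 1 , (st (take k w) , st (drop k w)))
  cutD : ℕ → ℤ × (Subst × Subst)
  cutD k = (+ 1 , cutSubst (φb w) k)
  cut-φ : ∀ k → ×.Pointwise _≡_ (×.Pointwise _~_ _~_) (map₂ φ² (cutM k)) (cutD k)
  cut-φ k = refl , sym Left.support~st , sym Right.support~st
    where open CutOfPerm w-perm k

φ-coproduct : ∀ {x} → InMPR x → φ⊗φ (ΔM x) ≃² ΔD (φ x)
φ-coproduct {x} x-perm = begin
  φ⊗φ (ΔM x)                                ≡⟨ lin-lin (basis ∘ φ²) ΔMb x ⟩
  lin (λ w → lin (basis ∘ φ²) (ΔMb w)) x    ≈⟨ lin⁺-All φb-coproduct x-perm ⟩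
  lin (λ w → ΔDb (φb w)) x                  ≡⟨ lin-lin-basis ΔDb φb x ⟨
  ΔD (φ x)                                  ∎
  where open ≃²-Reasoning

φ-counit : ∀ x → εD (φ x) ≡ εM x
φ-counit [] = refl
φ-counit ((c , []) ∷ x) = cong₂ _+ℤ_ (ℤ.*-identityʳ c) (φ-counit x)
φ-counit ((c , _ ∷ _) ∷ x) = cong (+ 0 +ℤ_) (φ-counit x)

φb-degree : ∀ w → degD (φb w) ≡ length w
φb-degree w = trans (cong length (deduplicate-unique (proj₁ (oneTo-isPerm (length w))))) (length-oneTo (length w))

-- Injectivity of φ

φb-injective : ∀ {b w} → IsPerm b → IsPerm w → φb b ~ φb w → b ≡ w
φb-injective {b} {w} b-perm w-perm φb~φw =
  map-injectiveOn (InjectiveOn-⊆ (⊆.xs⊆xs++ys (oneTo n) b) (canonRenaming-injective (φb b)))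
    (IsPerm⇒⊆oneTo b-perm) w⊆oneTo
    (trans (cong proj₂ φb~φw)
           (List.map-cong-local (All.tabulate (λ a∈ → sym (map-≡⇒agree first-components (w⊆oneTo a∈))))))
  where
  n : ℕ
  n = length b
  same-length : n ≡ length w
  same-length = trans (sym (length-map-oneTo _ n)) (trans (cong (length ∘ proj₁) φb~φw) (length-map-oneTo _ (length w)))
  w⊆oneTo : w ⊆ oneTo n
  w⊆oneTo = subst (λ m → w ⊆ oneTo m) (sym same-length) (IsPerm⇒⊆oneTo w-perm)
  first-components : map (canonRenaming (φb b)) (oneTo n) ≡ map (canonRenaming (φb w)) (oneTo n)
  first-components = trans (cong proj₁ φb~φw) (cong (map (canonRenaming (φb w)) ∘ oneTo) (sym same-length))

substEq-φb : ∀ {b w} → IsPerm b → IsPerm w → substEq (φb b) (φb w) ≡ wordEq b w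
substEq-φb {b} {w} b-perm w-perm = T-injective
  (λ t → subst (λ v → T (wordEq b v)) (φb-injective b-perm w-perm (substEq-sound t)) (wordEq-refl b))
  (λ t → subst (λ v → T (substEq (φb b) (φb v))) (wordEq-sound t) (substEq-refl (φb b)))

coeff-φ : ∀ {b} → IsPerm b → ∀ {x} → InMPR x → coeff substEq (φb b) (φ x) ≡ coeff wordEq b x
coeff-φ b-perm [] = refl
coeff-φ {b} b-perm {(c , w) ∷ x} (w-perm ∷ x-perm) = cong₂ _+ℤ_
  (cong₂ (λ t d → if t then d else + 0) (substEq-φb b-perm w-perm) (ℤ.*-identityʳ c))
  (coeff-φ b-perm x-perm)

coeff-nonPerm : ∀ {b} → ¬ IsPerm b → ∀ {x} → InMPR x → coeff wordEq b x ≡ + 0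
coeff-nonPerm ¬b-perm [] = refl
coeff-nonPerm {b} ¬b-perm {(c , w) ∷ x} (w-perm ∷ x-perm) = cong₂ _+ℤ_
  (cong (λ t → if t then c else + 0)
        (T-injective {wordEq b w} (λ t → ¬b-perm (subst IsPerm (sym (wordEq-sound t)) w-perm)) λ ()))
  (coeff-nonPerm ¬b-perm x-perm)

isPerm? : Decidable IsPerm
isPerm? w = unique? w ×-dec All.all? (λ a → (1 ℕ.≤? a) ×-dec (a ℕ.≤? length w)) w

φ-injective : ∀ {x y} → InMPR x → InMPR y → φ x ≈D φ y → x ≈M y
φ-injective x-perm y-perm φx≈φy b with isPerm? b
... | yes b-perm = trans (sym (coeff-φ b-perm x-perm)) (trans (φx≈φy (φb b)) (coeff-φ b-perm y-perm))
... | no ¬b-perm = trans (coeff-nonPerm ¬b-perm x-perm) (sym (coeff-nonPerm ¬b-perm y-perm))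

theorem7p2 :
  -- φ is injective (monomorphism)
  ((x y : MPR) → InMPR x → InMPR y → φ x ≈D φ y → x ≈M y)
  -- φ is graded: permutation words of length n go to substitutions of degree n
  × ((w : Word) → IsPerm w → degD (φb w) ≡ length w)
  -- φ preserves the unit
  × (φ unitM ≈D unitD)
  -- φ preserves the product
  × ((x y : MPR) → InMPR x → InMPR y → φ (mulM x y) ≈D mulD (φ x) (φ y))
  -- φ preserves the counit
  × ((x : MPR) → InMPR x → εD (φ x) ≡ εM x)
  -- φ preserves the coproduct
  × ((x : MPR) → InMPR x → φ⊗φ (ΔM x) ≈DD ΔD (φ x))
  -- φ commutes with the antipodes
  × ((x : MPR) → InMPR x → φ (SM x) ≈D SD (φ x))
theorem7p2 =
    (λ _ _ x-perm y-perm → φ-injective x-perm y-perm)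
  , (λ w _ → φb-degree w)
  , (λ _ → refl)
  , (λ _ _ x-perm y-perm → ≃⇒≈D (φ-mulM x-perm y-perm))
  , (λ x _ → φ-counit x)
  , (λ _ x-perm → ≃²⇒≈DD (φ-coproduct x-perm))
  , (λ _ x-perm → ≃⇒≈D (φ-antipode x-perm))
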